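{- Let $q$ be a prime power and $\omega\in\mathbb{F}_{q^6}$ an element of order $q^3+1$. If $x\in\langle\omega\rangle\setminus\mathbb{F}_{q^2}$, then $\mathrm{Tr}_{\mathbb{F}_{q^6}/\mathbb{F}_{q^2}}(x)\ne 1$. -}

module Defs where

open import Level using (Level; _⊔_) renaming (suc to lsuc)
open import Algebra.Bundles using (CommutativeRing)
open import Data.Nat using (ℕ; zero; suc; _<_; _^_)
open import Data.Nat.Primality using (Prime)
open import Data.Fin using (Fin)
open import Data.Product using (Σ; ∃; _×_)
open import Relation.Nullary using (¬_)
open import Relation.Binary.PropositionalEquality using (_≡_)

record Field (c ℓ : Level) : Set (lsuc (c ⊔ ℓ)) where
  field
    commutativeRing : CommutativeRing c ℓ
  open CommutativeRing commutativeRing public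
  field
    0≉1     : ¬ (0# ≈ 1#)
    inverse : ∀ x → ¬ (x ≈ 0#) → Σ Carrier λ y → (x * y) ≈ 1#

  pow : Carrier → ℕ → Carrier
  pow x zero    = 1#
  pow x (suc n) = x * pow x n

record HasCard {c ℓ} (F : Field c ℓ) (N : ℕ) : Set (c ⊔ ℓ) where
  open Field F
  field
    enum      : Fin N → Carrier
    enum-inj  : ∀ i j → enum i ≈ enum j → i ≡ j
    enum-surj : ∀ x → Σ (Fin N) λ i → enum i ≈ x

IsPrimePower : ℕ → Set
IsPrimePower q = ∃ λ p → ∃ λ k → Prime p × q ≡ p ^ suc k

module _ {c ℓ} (F : Field c ℓ) where
  open Field F

  HasOrder : Carrier → ℕ → Set ℓ
  HasOrder ω n = (pow ω n ≈ 1#) × (∀ m → 0 < m → m < n → ¬ (pow ω m ≈ 1#))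

  InSubgroup : Carrier → Carrier → Set ℓ
  InSubgroup ω x = ∃ λ k → pow ω k ≈ x

  -- For F = F_{q^6}: the subfield F_{q^2} = { x | x^(q^2) = x }
  InSubfield : ℕ → Carrier → Set ℓ
  InSubfield q x = pow x (q ^ 2) ≈ x

  Tr : ℕ → Carrier → Carrier
  Tr q x = x + pow x (q ^ 2) + pow x (q ^ 4)

-- Let F be a field with q⁶ elements, q = p^(k+1), and x an element of the subgroup
-- of order q³ + 1. Write x_j = x^(q^j) for the conjugates of x. Since |F| = q⁶ the
-- characteristic of F is p, so a ↦ a^q is additive (freshman's dream, iterated), and
-- x^(q³+1) = 1 gives x_j · x_{j+3} = 1. Raising the trace condition
--   x_0 + x_2 + x_4 = 1
-- to the q-th power gives x_1 + x_3 + x_5 = 1, that is x_4⁻¹ + x_0⁻¹ + x_2⁻¹ = 1, i.e.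
--   x_0 x_2 + x_2 x_4 + x_4 x_0 = x_0 x_2 x_4.
-- With e₁ = 1 and e₂ = e₃ the product (x_0 + x_2)(x_2 + x_4)(x_4 + x_0) = e₁e₂ − e₃
-- vanishes, so one of x_0, x_2, x_4 equals 1, and then x = 1 ∈ 𝔽_{q²}.
module Submission where

open import Defs
open import Level using (Level; _⊔_)
open import Data.Nat as ℕ using (ℕ; zero; suc; _∸_; _<_; _!; z≤n; s≤s)
import Data.Nat.Properties as ℕₚ
open import Data.Nat.Divisibility using (_∣_; divides; ∣1⇒≡1; ∣⇒≤; m∣m*n)
open import Data.Nat.DivMod using (m/n*n≡m)
open import Data.Nat.Primality using (Prime; euclidsLemma; ¬prime[0]; ¬prime[1])
open import Data.Nat.Combinatorics using (_C_; nCn≡1; nCk≡n!/k![n-k]!; k![n∸k]!∣n!)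
open import Data.Fin as Fin using (Fin; fromℕ; inject₁)
open import Data.Fin.Properties using (toℕ-fromℕ; inject₁ℕ<)
open import Data.Fin.Permutation using (Permutation; permutation)
open import Data.Vec.Functional using (replicate)
open import Data.Product using (_,_; proj₁; proj₂)
open import Data.Sum using (_⊎_; inj₁; inj₂)
open import Relation.Nullary using (¬_; yes; no; contradiction)
open import Relation.Binary.Definitions using (Decidable)
open import Relation.Binary.PropositionalEquality as ≡ using (_≡_)

prime∤! : ∀ {p} → Prime p → ∀ n → n < p → ¬ (p ∣ n !)
prime∤! p-prime zero    _   p∣1 = ¬prime[1] (≡.subst Prime (∣1⇒≡1 p∣1) p-prime)
prime∤! p-prime (suc n) n<p p∣[1+n]! with euclidsLemma (suc n) (n !) p-prime p∣[1+n]!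
... | inj₁ p∣1+n = ℕₚ.<⇒≱ n<p (∣⇒≤ p∣1+n)
... | inj₂ p∣n!  = prime∤! p-prime n (ℕₚ.<-trans (ℕₚ.n<1+n n) n<p) p∣n!

binomial*factorials : ∀ {n k} → k ℕ.≤ n → (n C k) ℕ.* (k ! ℕ.* (n ∸ k) !) ≡ n !
binomial*factorials {n} {k} k≤n =
  ≡.trans (≡.cong (ℕ._* (k ! ℕ.* (n ∸ k) !)) (nCk≡n!/k![n-k]! k≤n)) (m/n*n≡m (k![n∸k]!∣n! k≤n))
  where instance _ = k ℕₚ.!* (n ∸ k) !≢0

-- p divides the interior binomial coefficients p C k, 0 < k < p: it divides
-- p! = (p C k) · k! · (p − k)!, but neither k! nor (p − k)!.
prime∣binomial : ∀ {p k} → Prime p → 0 < k → k < p → p ∣ p C k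
prime∣binomial {p@(suc p-1)} {k} p-prime 0<k k<p
  with euclidsLemma (p C k) (k ! ℕ.* (p ∸ k) !) p-prime
         (≡.subst (p ∣_) (≡.sym (binomial*factorials (ℕₚ.<⇒≤ k<p))) (m∣m*n (p-1 !)))
... | inj₁ p∣pCk       = p∣pCk
... | inj₂ p∣k![p∸k]! with euclidsLemma (k !) ((p ∸ k) !) p-prime p∣k![p∸k]!
...   | inj₁ p∣k!      = contradiction p∣k! (prime∤! p-prime k k<p)
...   | inj₂ p∣[p∸k]!  =
  contradiction p∣[p∸k]! (prime∤! p-prime (p ∸ k) (ℕₚ.∸-monoʳ-< 0<k (ℕₚ.<⇒≤ k<p)))

-- Facts about an arbitrary field F. Exponentiation is the library's _^_ (Exp), which
-- agrees with the record's pow by pow≈^; n × a is the n-fold sum a + ⋯ + a.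
module FieldTheory {c ℓ} (F : Field c ℓ) where
  open Field F
  open import Algebra.Properties.Ring ring
    using (//-rightDividesˡ; //-rightDividesʳ; +-identityˡ-unique)
  open import Algebra.Properties.CommutativeSemiring.Exp commutativeSemiring
    using (_^_; ^-congˡ; ^-homo-*; ^-assocʳ)
  open import Algebra.Properties.Semiring.Mult semiring
    using (_×_; ×-congʳ; ×-homo-1; ×-assocˡ; ×-assoc-*; ×1-homo-*)
  open import Algebra.Properties.CommutativeMonoid.Sum +-commutativeMonoid
    using (sum; sum-cong-≋; sum-replicate; sum-replicate-zero; sum-init-last; ∑-distrib-+; ∑-permute)
  import Algebra.Properties.CommutativeSemiring.Binomial commutativeSemiring as Binomial
  open import Algebra.Solver.Ring.NaturalCoefficients.Default commutativeSemiring
    using (solve; _:=_; _:+_; _:*_)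
  open import Relation.Binary.Reasoning.Setoid setoid

  pow≈^ : ∀ x n → pow x n ≈ x ^ n
  pow≈^ x zero    = refl
  pow≈^ x (suc n) = *-congˡ (pow≈^ x n)

  1#^n≈1# : ∀ n → 1# ^ n ≈ 1#
  1#^n≈1# zero    = refl
  1#^n≈1# (suc n) = trans (*-identityˡ _) (1#^n≈1# n)

  subgroup-root-of-unity : ∀ {ω x n} → HasOrder F ω n → InSubgroup F ω x → x ^ n ≈ 1#
  subgroup-root-of-unity {ω} {x} {n} (ωⁿ≈1 , _) (i , ωⁱ≈x) = begin
    x ^ n          ≈⟨ ^-congˡ n (trans (sym ωⁱ≈x) (pow≈^ ω i)) ⟩
    (ω ^ i) ^ n    ≈⟨ ^-assocʳ ω i n ⟩
    ω ^ (i ℕ.* n)  ≡⟨ ≡.cong (ω ^_) (ℕₚ.*-comm i n) ⟩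
    ω ^ (n ℕ.* i)  ≈⟨ ^-assocʳ ω n i ⟨
    (ω ^ n) ^ i    ≈⟨ ^-congˡ i (trans (sym (pow≈^ ω n)) ωⁿ≈1) ⟩
    1# ^ i         ≈⟨ 1#^n≈1# i ⟩
    1#             ∎

  1∈subfield : ∀ q {x} → x ≈ 1# → InSubfield F q x
  1∈subfield q {x} x≈1 = begin
    pow x (q ℕ.^ 2)  ≈⟨ pow≈^ x (q ℕ.^ 2) ⟩
    x ^ (q ℕ.^ 2)    ≈⟨ ^-congˡ (q ℕ.^ 2) x≈1 ⟩
    1# ^ (q ℕ.^ 2)   ≈⟨ 1#^n≈1# (q ℕ.^ 2) ⟩
    1#               ≈⟨ x≈1 ⟨
    x                ∎

  -- The n-th power map is additive; for n = p^e in characteristic p it is the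
  -- e-th iterate of the Frobenius endomorphism.
  Additive : ℕ → Set (c ⊔ ℓ)
  Additive n = ∀ a b → (a + b) ^ n ≈ a ^ n + b ^ n

  additive-1 : Additive 1
  additive-1 a b = trans (*-identityʳ (a + b)) (sym (+-cong (*-identityʳ a) (*-identityʳ b)))

  additive-* : ∀ m n → Additive m → Additive n → Additive (m ℕ.* n)
  additive-* m n additiveₘ additiveₙ a b = begin
    (a + b) ^ (m ℕ.* n)            ≈⟨ ^-assocʳ (a + b) m n ⟨
    ((a + b) ^ m) ^ n              ≈⟨ ^-congˡ n (additiveₘ a b) ⟩
    (a ^ m + b ^ m) ^ n            ≈⟨ additiveₙ (a ^ m) (b ^ m) ⟩
    (a ^ m) ^ n + (b ^ m) ^ n      ≈⟨ +-cong (^-assocʳ a m n) (^-assocʳ b m n) ⟩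
    a ^ (m ℕ.* n) + b ^ (m ℕ.* n)  ∎

  additive-^ : ∀ p → Additive p → ∀ e → Additive (p ℕ.^ e)
  additive-^ p additiveₚ zero    = additive-1
  additive-^ p additiveₚ (suc e) = additive-* p (p ℕ.^ e) additiveₚ (additive-^ p additiveₚ e)

  multiple-of-char : ∀ {p n} → p × 1# ≈ 0# → p ∣ n → ∀ a → n × a ≈ 0#
  multiple-of-char {p} {n} p·1≈0 (divides d n≡d*p) a = begin
    n × a               ≡⟨ ≡.cong (_× a) (≡.trans n≡d*p (ℕₚ.*-comm d p)) ⟩
    (p ℕ.* d) × a       ≈⟨ ×-assocˡ a p d ⟨
    p × (d × a)         ≈⟨ ×-congʳ p (*-identityˡ (d × a)) ⟨
    p × (1# * d × a)    ≈⟨ ×-assoc-* p 1# (d × a) ⟨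
    (p × 1#) * (d × a)  ≈⟨ *-congʳ p·1≈0 ⟩
    0# * (d × a)        ≈⟨ zeroˡ (d × a) ⟩
    0#                  ∎

  -- Freshman's dream: in characteristic p, (a + b)^p = a^p + b^p, because in the binomial
  -- expansion every interior coefficient p C k (0 < k < p) is divisible by p.
  freshman's-dream : ∀ {p} → Prime p → p × 1# ≈ 0# → Additive p
  freshman's-dream {0} p-prime = contradiction p-prime ¬prime[0]
  freshman's-dream {1} p-prime = contradiction p-prime ¬prime[1]
  freshman's-dream {p@(suc (suc m))} p-prime p·1≈0 a b = begin
    (a + b) ^ p                                        ≈⟨ Binomial.theorem p a b ⟩
    term Fin.zero + sum (λ k → term (Fin.suc k))       ≈⟨ +-congˡ (sum-init-last (λ k → term (Fin.suc k))) ⟩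
    term Fin.zero + (sum interior + term (fromℕ p))    ≈⟨ +-cong (×-homo-1 _) (+-cong interior≈0 last-term) ⟩
    1# * b ^ p + (0# + a ^ p)                          ≈⟨ +-cong (*-identityˡ (b ^ p)) (+-identityˡ (a ^ p)) ⟩
    b ^ p + a ^ p                                      ≈⟨ +-comm (b ^ p) (a ^ p) ⟩
    a ^ p + b ^ p                                      ∎
    where
    term : Fin (suc p) → Carrier
    term = Binomial.binomialTerm a b p

    -- The terms with index 0 < k + 1 < p.
    interior : Fin (suc m) → Carrier
    interior k = term (Fin.suc (inject₁ k))

    interior-vanishes : ∀ k → interior k ≈ 0#
    interior-vanishes k = multiple-of-char p·1≈0
      (prime∣binomial p-prime (s≤s z≤n) (s≤s (inject₁ℕ< k))) (Binomial.binomial a b p (Fin.suc (inject₁ k)))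

    interior≈0 : sum interior ≈ 0#
    interior≈0 = trans (sum-cong-≋ interior-vanishes) (sum-replicate-zero (suc m))

    -- The last term (p C p) · aᵖ b⁰, indexed by any t ≡ p.
    top-term : ∀ t → t ≡ p → (p C t) × (a ^ t * b ^ (p ∸ t)) ≈ a ^ p
    top-term t ≡.refl = begin
      (p C p) × (a ^ p * b ^ (p ∸ p))  ≡⟨ ≡.cong₂ (λ n e → n × (a ^ p * b ^ e)) (nCn≡1 p) (ℕₚ.n∸n≡0 p) ⟩
      1 × (a ^ p * 1#)                 ≈⟨ ×-homo-1 _ ⟩
      a ^ p * 1#                       ≈⟨ *-identityʳ (a ^ p) ⟩
      a ^ p                            ∎

    last-term : term (fromℕ p) ≈ a ^ p
    last-term = top-term (Fin.toℕ (fromℕ p)) (toℕ-fromℕ p)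

  ×1-homo-^ : ∀ p e → (p ℕ.^ e) × 1# ≈ (p × 1#) ^ e
  ×1-homo-^ p zero    = ×-homo-1 1#
  ×1-homo-^ p (suc e) = trans (×1-homo-* p (p ℕ.^ e)) (*-congˡ (×1-homo-^ p e))

  module IntegralDomain (_≟_ : Decidable _≈_) where

    zero-product : ∀ a b → a * b ≈ 0# → a ≈ 0# ⊎ b ≈ 0#
    zero-product a b ab≈0 with a ≟ 0#
    ... | yes a≈0 = inj₁ a≈0
    ... | no  a≉0 with inverse a a≉0
    ...   | a⁻¹ , aa⁻¹≈1 = inj₂ (begin
      b               ≈⟨ *-identityˡ b ⟨
      1# * b          ≈⟨ *-congʳ (trans (sym aa⁻¹≈1) (*-comm a a⁻¹)) ⟩
      a⁻¹ * a * b     ≈⟨ *-assoc a⁻¹ a b ⟩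
      a⁻¹ * (a * b)   ≈⟨ *-congˡ ab≈0 ⟩
      a⁻¹ * 0#        ≈⟨ zeroʳ a⁻¹ ⟩
      0#              ∎)

    ^≈0⇒≈0 : ∀ a n → a ^ n ≈ 0# → a ≈ 0#
    ^≈0⇒≈0 a zero    1≈0    = contradiction (sym 1≈0) 0≉1
    ^≈0⇒≈0 a (suc n) aⁿ⁺¹≈0 with zero-product a (a ^ n) aⁿ⁺¹≈0
    ... | inj₁ a≈0  = a≈0
    ... | inj₂ aⁿ≈0 = ^≈0⇒≈0 a n aⁿ≈0

    -- If the elementary symmetric functions of x, y, z satisfy e₁ = 1 and e₂ = e₃, then one
    -- of x, y, z is 1: the product (x + y)(y + z)(z + x) = e₁e₂ − e₃ vanishes, and if
    -- s + t = 0 for two of the three then the third equals e₁ = 1.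
    symmetric-one : ∀ x y z → x + y + z ≈ 1# → x * y + y * z + z * x ≈ x * y * z →
                    x ≈ 1# ⊎ y ≈ 1# ⊎ z ≈ 1#
    symmetric-one x y z e₁≈1 e₂≈e₃ = one-of (zero-product _ _ product≈0)
      where
      product≈0 : (x + y) * (y + z) * (z + x) ≈ 0#
      product≈0 = +-identityˡ-unique _ (x * y * z) (begin
        (x + y) * (y + z) * (z + x) + x * y * z
          ≈⟨ solve 3 (λ x y z → (x :+ y) :* (y :+ z) :* (z :+ x) :+ x :* y :* z
                             := (x :+ y :+ z) :* (x :* y :+ y :* z :+ z :* x)) refl x y z ⟩
        (x + y + z) * (x * y + y * z + z * x)  ≈⟨ *-cong e₁≈1 e₂≈e₃ ⟩
        1# * (x * y * z)                       ≈⟨ *-identityˡ (x * y * z) ⟩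
        x * y * z                              ∎)

      remaining-one : ∀ s t → s ≈ 0# → s + t ≈ 1# → t ≈ 1#
      remaining-one s t s≈0 s+t≈1 = trans (sym (+-identityˡ t)) (trans (+-congʳ (sym s≈0)) s+t≈1)

      one-of : (x + y) * (y + z) ≈ 0# ⊎ z + x ≈ 0# → x ≈ 1# ⊎ y ≈ 1# ⊎ z ≈ 1#
      one-of (inj₂ z+x≈0) = inj₂ (inj₁ (remaining-one (z + x) y z+x≈0
        (trans (solve 3 (λ x y z → (z :+ x) :+ y := x :+ y :+ z) refl x y z) e₁≈1)))
      one-of (inj₁ [x+y][y+z]≈0) with zero-product _ _ [x+y][y+z]≈0
      ... | inj₁ x+y≈0 = inj₂ (inj₂ (remaining-one (x + y) z x+y≈0 e₁≈1))
      ... | inj₂ y+z≈0 = inj₁ (remaining-one (y + z) x y+z≈0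
        (trans (solve 3 (λ x y z → (y :+ z) :+ x := x :+ y :+ z) refl x y z) e₁≈1))

  module Finite {N} (card : HasCard F N) where
    open HasCard card

    index : Carrier → Fin N
    index a = proj₁ (enum-surj a)

    enum-index : ∀ a → enum (index a) ≈ a
    enum-index a = proj₂ (enum-surj a)

    _≟_ : Decidable _≈_
    a ≟ b with index a Fin.≟ index b
    ... | yes ia≡ib = yes (trans (sym (enum-index a)) (trans (reflexive (≡.cong enum ia≡ib)) (enum-index b)))
    ... | no  ia≢ib = no (λ a≈b → ia≢ib (enum-inj _ _ (trans (enum-index a) (trans a≈b (sym (enum-index b))))))

    shift : Carrier → Fin N → Fin N
    shift a i = index (enum i + a)

    shift-cancel : ∀ a b → (∀ e → e + a + b ≈ e) → ∀ i → shift b (shift a i) ≡ i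
    shift-cancel a b cancels i = enum-inj _ _ (begin
      enum (shift b (shift a i))  ≈⟨ enum-index _ ⟩
      enum (shift a i) + b        ≈⟨ +-congʳ (enum-index _) ⟩
      enum i + a + b              ≈⟨ cancels (enum i) ⟩
      enum i                      ∎)

    translation : Carrier → Permutation N N
    translation a = permutation (shift a) (shift (- a))
      (shift-cancel (- a) a (//-rightDividesˡ a)) (shift-cancel a (- a) (//-rightDividesʳ a))

    -- Lagrange's theorem for (F, +): N · a = 0, as translation by a permutes F and so
    -- Σ_i e_i = Σ_i (e_i + a) = Σ_i e_i + N · a.
    card×≈0 : ∀ a → N × a ≈ 0#
    card×≈0 a = +-identityˡ-unique (N × a) (sum enum) (begin
      N × a + sum enum                ≈⟨ +-comm (N × a) (sum enum) ⟩
      sum enum + N × a                ≈⟨ +-congˡ (sum-replicate N) ⟨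
      sum enum + sum (replicate N a)  ≈⟨ ∑-distrib-+ enum (replicate N a) ⟨
      sum (λ i → enum i + a)          ≈⟨ sum-cong-≋ (λ i → enum-index (enum i + a)) ⟨
      sum (λ i → enum (shift a i))    ≈⟨ ∑-permute enum (translation a) ⟨
      sum enum                        ∎)

    -- If F has p^e elements then p · 1 = 0, as (p · 1)^e = p^e · 1 = 0.
    characteristic : ∀ p e → N ≡ p ℕ.^ e → p × 1# ≈ 0#
    characteristic p e N≡pᵉ = ^≈0⇒≈0 (p × 1#) e (begin
      (p × 1#) ^ e    ≈⟨ ×1-homo-^ p e ⟨
      (p ℕ.^ e) × 1#  ≡⟨ ≡.cong (_× 1#) (≡.sym N≡pᵉ) ⟩
      N × 1#          ≈⟨ card×≈0 1# ⟩
      0#              ∎)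
      where open IntegralDomain _≟_

  module NormOne (_≟_ : Decidable _≈_) (q : ℕ) (additive : Additive q)
                 (x : Carrier) (norm≈1 : x ^ (q ℕ.^ 3 ℕ.+ 1) ≈ 1#) where
    open IntegralDomain _≟_

    conj : ℕ → Carrier
    conj j = x ^ (q ℕ.^ j)

    conj-0 : conj 0 ≈ x
    conj-0 = *-identityʳ x

    conj-suc : ∀ j → conj j ^ q ≈ conj (suc j)
    conj-suc j = begin
      (x ^ (q ℕ.^ j)) ^ q  ≈⟨ ^-assocʳ x (q ℕ.^ j) q ⟩
      x ^ (q ℕ.^ j ℕ.* q)  ≡⟨ ≡.cong (x ^_) (ℕₚ.*-comm (q ℕ.^ j) q) ⟩
      x ^ (q ℕ.^ suc j)    ∎

    conj-inverse : ∀ j → conj j * conj (3 ℕ.+ j) ≈ 1#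
    conj-inverse j = begin
      x ^ qʲ * x ^ (q ℕ.^ (3 ℕ.+ j))  ≈⟨ ^-homo-* x qʲ (q ℕ.^ (3 ℕ.+ j)) ⟨
      x ^ (qʲ ℕ.+ q ℕ.^ (3 ℕ.+ j))    ≡⟨ ≡.cong (x ^_) exponent ⟩
      x ^ ((q ℕ.^ 3 ℕ.+ 1) ℕ.* qʲ)    ≈⟨ ^-assocʳ x (q ℕ.^ 3 ℕ.+ 1) qʲ ⟨
      (x ^ (q ℕ.^ 3 ℕ.+ 1)) ^ qʲ      ≈⟨ ^-congˡ qʲ norm≈1 ⟩
      1# ^ qʲ                         ≈⟨ 1#^n≈1# qʲ ⟩
      1#                              ∎
      where
      qʲ : ℕ
      qʲ = q ℕ.^ j
      exponent : qʲ ℕ.+ q ℕ.^ (3 ℕ.+ j) ≡ (q ℕ.^ 3 ℕ.+ 1) ℕ.* qʲ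
      exponent = ≡.trans (≡.cong (qʲ ℕ.+_) (ℕₚ.^-distribˡ-+-* q 3 j))
                         (≡.cong (ℕ._* qʲ) (ℕₚ.+-comm 1 (q ℕ.^ 3)))

    -- Conjugates equal to 1 propagate: x_j = 1 gives x_{j+1} = 1^q = 1, and
    -- x_{j+3} = 1 gives x_j = x_j · x_{j+3} = 1; hence x_2 = 1 or x_4 = 1 forces x_0 = 1.
    conj-one-suc : ∀ j → conj j ≈ 1# → conj (suc j) ≈ 1#
    conj-one-suc j xⱼ≈1 = trans (sym (conj-suc j)) (trans (^-congˡ q xⱼ≈1) (1#^n≈1# q))

    conj-one-back : ∀ j → conj (3 ℕ.+ j) ≈ 1# → conj j ≈ 1#
    conj-one-back j xⱼ₊₃≈1 = trans (sym (*-identityʳ (conj j))) (trans (*-congˡ (sym xⱼ₊₃≈1)) (conj-inverse j))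

    conj₂-one : conj 2 ≈ 1# → conj 0 ≈ 1#
    conj₂-one x₂≈1 = conj-one-back 0 (conj-one-suc 2 x₂≈1)

    conj₄-one : conj 4 ≈ 1# → conj 0 ≈ 1#
    conj₄-one x₄≈1 = conj₂-one (conj-one-back 2 (conj-one-suc 4 x₄≈1))

    trace-shift : ∀ j → conj j + conj (2 ℕ.+ j) + conj (4 ℕ.+ j) ≈ 1# →
                  conj (suc j) + conj (3 ℕ.+ j) + conj (5 ℕ.+ j) ≈ 1#
    trace-shift j trace≈1 = begin
      conj (suc j) + conj (3 ℕ.+ j) + conj (5 ℕ.+ j)
        ≈⟨ +-cong (+-cong (conj-suc j) (conj-suc (2 ℕ.+ j))) (conj-suc (4 ℕ.+ j)) ⟨
      xⱼ ^ q + xⱼ₊₂ ^ q + xⱼ₊₄ ^ q  ≈⟨ +-congʳ (additive xⱼ xⱼ₊₂) ⟨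
      (xⱼ + xⱼ₊₂) ^ q + xⱼ₊₄ ^ q    ≈⟨ additive (xⱼ + xⱼ₊₂) xⱼ₊₄ ⟨
      (xⱼ + xⱼ₊₂ + xⱼ₊₄) ^ q        ≈⟨ ^-congˡ q trace≈1 ⟩
      1# ^ q                        ≈⟨ 1#^n≈1# q ⟩
      1#                            ∎
      where
      xⱼ xⱼ₊₂ xⱼ₊₄ : Carrier
      xⱼ   = conj j
      xⱼ₊₂ = conj (2 ℕ.+ j)
      xⱼ₊₄ = conj (4 ℕ.+ j)

    -- Since x_1 = x_4⁻¹, x_3 = x_0⁻¹ and x_5 = x_2⁻¹, the shifted trace condition says
    -- e₂ = e₃ for x_0, x_2, x_4.
    pairs≈product : conj 1 + conj 3 + conj 5 ≈ 1# →
                    conj 0 * conj 2 + conj 2 * conj 4 + conj 4 * conj 0 ≈ conj 0 * conj 2 * conj 4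
    pairs≈product shifted≈1 = begin
      x₀ * x₂ + x₂ * x₄ + x₄ * x₀
        ≈⟨ +-cong (+-cong (times-one (trans (*-comm x₄ x₁) (conj-inverse 1))) (times-one (conj-inverse 0)))
                  (times-one (conj-inverse 2)) ⟨
      x₀ * x₂ * (x₄ * x₁) + x₂ * x₄ * (x₀ * x₃) + x₄ * x₀ * (x₂ * x₅)
        ≈⟨ solve 6 (λ x₀ x₁ x₂ x₃ x₄ x₅ →
                      x₀ :* x₂ :* (x₄ :* x₁) :+ x₂ :* x₄ :* (x₀ :* x₃) :+ x₄ :* x₀ :* (x₂ :* x₅)
                   := x₀ :* x₂ :* x₄ :* (x₁ :+ x₃ :+ x₅)) refl x₀ x₁ x₂ x₃ x₄ x₅ ⟩
      x₀ * x₂ * x₄ * (x₁ + x₃ + x₅)  ≈⟨ *-congˡ shifted≈1 ⟩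
      x₀ * x₂ * x₄ * 1#              ≈⟨ *-identityʳ (x₀ * x₂ * x₄) ⟩
      x₀ * x₂ * x₄                   ∎
      where
      x₀ x₁ x₂ x₃ x₄ x₅ : Carrier
      x₀ = conj 0
      x₁ = conj 1
      x₂ = conj 2
      x₃ = conj 3
      x₄ = conj 4
      x₅ = conj 5

      times-one : ∀ {a u} → u ≈ 1# → a * u ≈ a
      times-one {a} u≈1 = trans (*-congˡ u≈1) (*-identityʳ a)

    trace-one⇒one : Tr F q x ≈ 1# → x ≈ 1#
    trace-one⇒one Tr≈1 = trans (sym conj-0) (x₀-one
      (symmetric-one (conj 0) (conj 2) (conj 4) trace≈1 (pairs≈product (trace-shift 0 trace≈1))))
      where
      trace≈1 : conj 0 + conj 2 + conj 4 ≈ 1#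
      trace≈1 = trans (+-cong (+-cong conj-0 (sym (pow≈^ x (q ℕ.^ 2)))) (sym (pow≈^ x (q ℕ.^ 4)))) Tr≈1

      x₀-one : conj 0 ≈ 1# ⊎ conj 2 ≈ 1# ⊎ conj 4 ≈ 1# → conj 0 ≈ 1#
      x₀-one (inj₁ x₀≈1)        = x₀≈1
      x₀-one (inj₂ (inj₁ x₂≈1)) = conj₂-one x₂≈1
      x₀-one (inj₂ (inj₂ x₄≈1)) = conj₄-one x₄≈1

open import Data.Nat using (_+_; _^_)

lemma2p2 : ∀ {c ℓ : Level} (q : ℕ) → IsPrimePower q →
           (F : Field c ℓ) → HasCard F (q ^ 6) →
           (ω : Field.Carrier F) → HasOrder F ω (q ^ 3 + 1) →
           (x : Field.Carrier F) → InSubgroup F ω x → ¬ InSubfield F q x →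
           ¬ (Field._≈_ F (Tr F q x) (Field.1# F))
lemma2p2 q (p , k , p-prime , q≡p^[1+k]) F card ω ω-order x x∈⟨ω⟩ x∉𝔽q² Tr≈1 =
  x∉𝔽q² (1∈subfield q
    (NormOne.trace-one⇒one _≟_ q q-additive x (subgroup-root-of-unity ω-order x∈⟨ω⟩) Tr≈1))
  where
  open FieldTheory F
  open Finite card using (_≟_; characteristic)

  -- |F| = q⁶ is a power of p, so F has characteristic p and a ↦ a^q is additive.
  card≡p^ : q ^ 6 ≡ p ^ (suc k ℕ.* 6)
  card≡p^ = ≡.trans (≡.cong (_^ 6) q≡p^[1+k]) (ℕₚ.^-*-assoc p (suc k) 6)

  q-additive : Additive q
  q-additive = ≡.subst Additive (≡.sym q≡p^[1+k])
    (additive-^ p (freshman's-dream p-prime (characteristic p (suc k ℕ.* 6) card≡p^)) (suc k))
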